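{- For every integer $m\ge 9$, the set $$K=\{0,1,\ldots,m+7\}\setminus\{3,5,6,m+1,m+2,m+3,m+5\}=\{0,1,2,4\}\cup\{7,8,\ldots,m\}\cup\{m+4,m+6,m+7\}$$ is sum-dominant.
   Context: For a finite set $A\subseteq\mathbb{N}$, define the sum set $A+A=\{a_i+a_j : a_i,a_j\in A\}$ and the difference set $A-A=\{a_i-a_j : a_i,a_j\in A\}$. The set $A$ is called sum-dominant if $|A+A|>|A-A|$. -}

module Defs where

open import Data.Nat as ℕ using (ℕ; _+_; _<_)
open import Data.Integer as ℤ using (ℤ)
open import Data.List using (List; length; upTo; filter; deduplicate; map; concatMap; _∷_; [])
open import Data.List.Membership.DecPropositional ℕ._≟_ using (_∉?_)

-- A finite set of naturals is represented by a list of its elements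
-- (repetitions allowed); its cardinality counts distinct elements.

cardℕ : List ℕ → ℕ
cardℕ xs = length (deduplicate ℕ._≟_ xs)

cardℤ : List ℤ → ℕ
cardℤ xs = length (deduplicate ℤ._≟_ xs)

sumset : List ℕ → List ℕ
sumset A = concatMap (λ a → map (λ b → a + b) A) A

diffset : List ℕ → List ℤ
diffset A = concatMap (λ a → map (λ b → ℤ.+ a ℤ.- ℤ.+ b) A) A

SumDominant : List ℕ → Set
SumDominant A = cardℤ (diffset A) < cardℕ (sumset A)

K : ℕ → List ℕ
K m = filter (_∉? (3 ∷ 5 ∷ 6 ∷ (m + 1) ∷ (m + 2) ∷ (m + 3) ∷ (m + 5) ∷ [])) (upTo (m + 8))

module Submission where

-- For m ≥ 9 the set K = {0,1,2,4} ∪ [7,m] ∪ {m+4,m+6,m+7} ⊆ [0,m+7]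
-- is sum-dominant:  |K + K| ≥ 2m + 14 > 2m + 13 ≥ |K − K|.
--
-- Sum set: every n ≤ 2m + 14 except 2m + 9 is a sum of two elements of K.
-- Sums below 7 and the sums m + k (1 ≤ k ≤ 13) come from short explicit
-- tables; the remaining ones are x + j with x ∈ {0, m + 7} and j in the
-- interval [7,m] ⊆ K, or sums of two of the three top elements.
-- Difference set: a − b = i − (m + 7) with 0 ≤ i ≤ 2m + 14, and the two
-- values i = 6, i = 2m + 8 would mean a ∓ b = ±(m + 1); this is impossible
-- because every a < 7 is either a low gap {3,5,6} of K or a + (m + 1) is a
-- high gap {m+1,m+2,m+3,m+5} of K.

open import Defs
open import Data.Nat using (ℕ; _≤_)
open import Data.Nat as ℕ using (suc; _+_; _∸_; _<_; z≤n; s≤s; z<s; s≤s⁻¹; _<?_; _≤?_)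
open import Data.Nat.Properties
open import Data.Nat.Tactic.RingSolver using (solve)
open import Data.Integer as ℤ using (ℤ; _⊖_)
open import Data.Integer.Properties using ([+m]-[+n]≡m⊖n; +-cancelˡ-⊖)
open import Data.List using (List; []; _∷_; length; upTo; map; _++_)
open import Data.List.Properties using (length-++; length-map; length-upTo; length-removeAt′)
open import Data.List.Membership.Propositional using (_∈_; _∉_; find)
open import Data.List.Membership.Propositional.Properties
open import Data.List.Membership.DecPropositional ℕ._≟_ using (_∉?_)
open import Data.List.Relation.Binary.Subset.Propositional using (_⊆_)
open import Data.List.Relation.Unary.All as All using (All; all?)
open import Data.List.Relation.Unary.Any as Any using (here; there; index; _─_)
import Data.List.Relation.Unary.AllPairs as AllPairs
open import Data.List.Relation.Unary.Unique.Propositional using (Unique)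
import Data.List.Relation.Unary.Unique.Propositional.Properties as Unique
open import Data.List.Relation.Unary.Unique.DecPropositional.Properties using (deduplicate-!)
open import Data.Empty using (⊥-elim)
open import Data.Product using (_×_; _,_; ∃; ∃₂; proj₁)
open import Data.Sum using (_⊎_; inj₁; inj₂)
open import Relation.Nullary using (¬_; yes; no)
open import Relation.Nullary.Decidable using (from-yes; True; toWitness)
open import Relation.Binary.PropositionalEquality

module _ {a} {A : Set a} where

  ∈-─ : ∀ {x z} {ys : List A} (x∈ys : x ∈ ys) → z ∈ ys → z ≢ x → z ∈ (ys ─ x∈ys)
  ∈-─ (here refl) (here refl) z≢x = ⊥-elim (z≢x refl)
  ∈-─ (here refl) (there z∈ys) _ = z∈ys
  ∈-─ (there x∈ys) (here refl) _ = here refl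
  ∈-─ (there x∈ys) (there z∈ys) z≢x = there (∈-─ x∈ys z∈ys z≢x)

  unique-⊆⇒length≤ : ∀ {xs ys : List A} → Unique xs → xs ⊆ ys → length xs ≤ length ys
  unique-⊆⇒length≤ {[]} _ _ = z≤n
  unique-⊆⇒length≤ {x ∷ xs} {ys} (x∉xs AllPairs.∷ xs-unique) x∷xs⊆ys = begin
    suc (length xs)           ≤⟨ s≤s (unique-⊆⇒length≤ xs-unique xs⊆rest) ⟩
    suc (length (ys ─ x∈ys))  ≡⟨ length-removeAt′ ys (index x∈ys) ⟨
    length ys                 ∎
    where
    open ≤-Reasoning
    x∈ys : x ∈ ys
    x∈ys = x∷xs⊆ys (here refl)
    xs⊆rest : xs ⊆ (ys ─ x∈ys)
    xs⊆rest z∈xs = ∈-─ x∈ys (x∷xs⊆ys (there z∈xs)) (λ z≡x → All.lookup x∉xs z∈xs (sym z≡x))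

length≤cardℕ : ∀ {S xs} → Unique S → S ⊆ xs → length S ≤ cardℕ xs
length≤cardℕ S-unique S⊆xs = unique-⊆⇒length≤ S-unique (λ z∈S → ∈-deduplicate⁺ ℕ._≟_ (S⊆xs z∈S))

cardℤ≤length : ∀ {xs D} → xs ⊆ D → cardℤ xs ≤ length D
cardℤ≤length {xs} xs⊆D =
  unique-⊆⇒length≤ (deduplicate-! ℤ._≟_ xs) (λ z∈ → xs⊆D (∈-deduplicate⁻ ℤ._≟_ xs z∈))

<+suc⇒≤+ : ∀ {k m d} → k < m + suc d → k ≤ m + d
<+suc⇒≤+ {k} {m} {d} k<m+1+d = s≤s⁻¹ (subst (k <_) (+-suc m d) k<m+1+d)

∈-sumset : ∀ {A a b} → a ∈ A → b ∈ A → a + b ∈ sumset A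
∈-sumset {A} {a} a∈A b∈A =
  ∈-concatMap⁺ (λ x → map (λ y → x + y) A) (Any.map (λ { refl → ∈-map⁺ (a +_) b∈A }) a∈A)

sum-of : ∀ {A a b} n → a ∈ A → b ∈ A → n ≡ a + b → n ∈ sumset A
sum-of _ a∈A b∈A refl = ∈-sumset a∈A b∈A

∈-diffset⁻ : ∀ {A z} → z ∈ diffset A → ∃₂ λ a b → a ∈ A × b ∈ A × z ≡ ℤ.+ a ℤ.- ℤ.+ b
∈-diffset⁻ {A} z∈ with a , a∈A , z∈row ← find (∈-concatMap⁻ _ {xs = A} z∈)
                  with b , b∈A , z≡ ← ∈-map⁻ (λ b → ℤ.+ a ℤ.- ℤ.+ b) z∈row
  = a , b , a∈A , b∈A , z≡

difference-shift : ∀ a b c i → b + i ≡ a + c → ℤ.+ a ℤ.- ℤ.+ b ≡ ℤ.+ i ℤ.- ℤ.+ c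
difference-shift a b c i b+i≡a+c = begin
  ℤ.+ a ℤ.- ℤ.+ b    ≡⟨ [+m]-[+n]≡m⊖n a b ⟩
  a ⊖ b              ≡⟨ +-cancelˡ-⊖ c a b ⟨
  (c + a) ⊖ (c + b)  ≡⟨ cong₂ _⊖_ (trans (+-comm c a) (sym b+i≡a+c)) (+-comm c b) ⟩
  (b + i) ⊖ (b + c)  ≡⟨ +-cancelˡ-⊖ b i c ⟩
  i ⊖ c              ≡⟨ [+m]-[+n]≡m⊖n i c ⟨
  ℤ.+ i ℤ.- ℤ.+ c    ∎
  where open ≡-Reasoning

skip : ℕ → List ℕ → List ℕ
skip k xs = upTo k ++ map (suc k +_) xs

length-skip : ∀ k xs → length (skip k xs) ≡ k + length xs
length-skip k xs = begin
  length (upTo k ++ map (suc k +_) xs)        ≡⟨ length-++ (upTo k) ⟩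
  length (upTo k) + length (map (suc k +_) xs) ≡⟨ cong₂ _+_ (length-upTo k) (length-map (suc k +_) xs) ⟩
  k + length xs                               ∎
  where open ≡-Reasoning

unique-skip : ∀ k {xs} → Unique xs → Unique (skip k xs)
unique-skip k {xs} xs-unique =
  Unique.++⁺ (Unique.upTo⁺ k) (Unique.map⁺ (+-cancelˡ-≡ (suc k) _ _) xs-unique) disjoint
  where
  disjoint : ∀ {v} → ¬ (v ∈ upTo k × v ∈ map (suc k +_) xs)
  disjoint (v∈upTo , v∈shifted) with j , _ , refl ← ∈-map⁻ (suc k +_) v∈shifted =
    <⇒≱ (∈-upTo⁻ v∈upTo) (≤-trans (n≤1+n k) (m≤m+n (suc k) j))

∈-skip⁺ : ∀ {k xs i} → i ≢ k → (∀ {j} → i ≡ suc k + j → j ∈ xs) → i ∈ skip k xs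
∈-skip⁺ {k} {xs} {i} i≢k shifted∈ with i <? k
... | yes i<k = ∈-++⁺ˡ (∈-upTo⁺ i<k)
... | no i≮k with j , refl ← m≤n⇒∃[o]m+o≡n (≤∧≢⇒< (≮⇒≥ i≮k) (λ k≡i → i≢k (sym k≡i))) =
  ∈-++⁺ʳ (upTo k) (∈-map⁺ (suc k +_) (shifted∈ refl))

∈-skip⁻ : ∀ {k xs i} → i ∈ skip k xs → i < k ⊎ ∃ λ j → j ∈ xs × i ≡ suc k + j
∈-skip⁻ {k} i∈ with ∈-++⁻ (upTo k) i∈
... | inj₁ i∈upTo    = inj₁ (∈-upTo⁻ i∈upTo)
... | inj₂ i∈shifted = inj₂ (∈-map⁻ (suc k +_) i∈shifted)

LowGaps : List ℕ
LowGaps = 3 ∷ 5 ∷ 6 ∷ []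

HighGaps : List ℕ
HighGaps = 1 ∷ 2 ∷ 3 ∷ 5 ∷ []

Gaps : ℕ → List ℕ
Gaps m = LowGaps ++ map (m +_) HighGaps

∈K⁺ : ∀ {m a} → a < m + 8 → a ∉ LowGaps → (∀ {h} → h ∈ HighGaps → a ≢ m + h) → a ∈ K m
∈K⁺ {m} {a} a<m+8 a∉low a∉high = ∈-filter⁺ (_∉? Gaps m) (∈-upTo⁺ a<m+8) a∉Gaps
  where
  a∉Gaps : a ∉ Gaps m
  a∉Gaps a∈ with ∈-++⁻ LowGaps a∈
  ... | inj₁ a∈low = a∉low a∈low
  ... | inj₂ a∈high with h , h∈ , a≡m+h ← ∈-map⁻ (m +_) a∈high = a∉high h∈ a≡m+h

∈K⁻ : ∀ {m a} → a ∈ K m → a < m + 8 × a ∉ Gaps m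
∈K⁻ {m} a∈K with a∈upTo , a∉Gaps ← ∈-filter⁻ (_∉? Gaps m) a∈K = ∈-upTo⁻ a∈upTo , a∉Gaps

∈K⇒≤m+7 : ∀ {m a} → a ∈ K m → a ≤ m + 7
∈K⇒≤m+7 {m} a∈K = <+suc⇒≤+ (proj₁ (∈K⁻ {m} a∈K))

LowGaps<7 : All (_< 7) LowGaps
LowGaps<7 = from-yes (all? (_<? 7) LowGaps)

HighGaps>0 : All (0 <_) HighGaps
HighGaps>0 = from-yes (all? (0 <?_) HighGaps)

low∈K : ∀ {m a} → 9 ≤ m → a ∈ 0 ∷ 1 ∷ 2 ∷ 4 ∷ [] → a ∈ K m
low∈K {m} {a} 9≤m a∈ =
  ∈K⁺ (<-≤-trans a<m (m≤m+n m 8)) (All.lookup notGaps a∈)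
      (λ {h} _ → <⇒≢ (<-≤-trans a<m (m≤m+n m h)))
  where
  notGaps : All (_∉ LowGaps) (0 ∷ 1 ∷ 2 ∷ 4 ∷ [])
  notGaps = from-yes (all? (_∉? LowGaps) (0 ∷ 1 ∷ 2 ∷ 4 ∷ []))
  a<m : a < m
  a<m = <-≤-trans (All.lookup (from-yes (all? (_<? 9) (0 ∷ 1 ∷ 2 ∷ 4 ∷ []))) a∈) 9≤m

mid∈K : ∀ {m a} → 7 ≤ a → a ≤ m → a ∈ K m
mid∈K {m} 7≤a a≤m =
  ∈K⁺ (≤-<-trans a≤m (m<m+n m z<s))
      (λ a∈low → <⇒≱ (All.lookup LowGaps<7 a∈low) 7≤a)
      (λ h∈ → <⇒≢ (≤-<-trans a≤m (m<m+n m (All.lookup HighGaps>0 h∈))))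

top∈K : ∀ {m j} → 9 ≤ m → j ∈ 4 ∷ 6 ∷ 7 ∷ [] → m + j ∈ K m
top∈K {m} {j} 9≤m j∈ =
  ∈K⁺ (+-monoʳ-< m (All.lookup (from-yes (all? (_<? 8) (4 ∷ 6 ∷ 7 ∷ []))) j∈))
      (λ m+j∈low → <⇒≱ (All.lookup LowGaps<7 m+j∈low) 7≤m+j)
      (λ {h} h∈ m+j≡m+h → All.lookup notGaps j∈ (subst (_∈ HighGaps) (sym (+-cancelˡ-≡ m j h m+j≡m+h)) h∈))
  where
  notGaps : All (_∉ HighGaps) (4 ∷ 6 ∷ 7 ∷ [])
  notGaps = from-yes (all? (_∉? HighGaps) (4 ∷ 6 ∷ 7 ∷ []))
  7≤m+j : 7 ≤ m + j
  7≤m+j = ≤-trans (≤-trans (from-yes (7 ≤? 9)) 9≤m) (m≤m+n m j)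

low-or-high : ∀ {a} → a < 7 → a ∈ LowGaps ⊎ suc a ∈ HighGaps
low-or-high {0} _ = inj₂ (here refl)
low-or-high {1} _ = inj₂ (there (here refl))
low-or-high {2} _ = inj₂ (there (there (here refl)))
low-or-high {3} _ = inj₁ (here refl)
low-or-high {4} _ = inj₂ (there (there (there (here refl))))
low-or-high {5} _ = inj₁ (there (here refl))
low-or-high {6} _ = inj₁ (there (there (here refl)))
low-or-high {suc (suc (suc (suc (suc (suc (suc _))))))} (s≤s (s≤s (s≤s (s≤s (s≤s (s≤s (s≤s ())))))))

no-difference-m+1 : ∀ {m a b} → a ∈ K m → b ∈ K m → b ≢ m + suc a
no-difference-m+1 {m} {a} a∈K b∈K refl
  with _ , a∉Gaps ← ∈K⁻ {m} a∈K | b<m+8 , b∉Gaps ← ∈K⁻ {m} b∈K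
  with low-or-high (s≤s⁻¹ (+-cancelˡ-< m (suc a) 8 b<m+8))
... | inj₁ a∈low    = a∉Gaps (∈-++⁺ˡ a∈low)
... | inj₂ 1+a∈high = b∉Gaps (∈-++⁺ʳ LowGaps (∈-map⁺ (m +_) 1+a∈high))

module SumSet (m : ℕ) (9≤m : 9 ≤ m) where

  literal≤m : ∀ d → {True (d ≤? 9)} → d ≤ m
  literal≤m _ {d≤9} = ≤-trans (toWitness d≤9) 9≤m

  0∈K : 0 ∈ K m
  0∈K = low∈K 9≤m (here refl)
  1∈K : 1 ∈ K m
  1∈K = low∈K 9≤m (there (here refl))
  2∈K : 2 ∈ K m
  2∈K = low∈K 9≤m (there (there (here refl)))
  4∈K : 4 ∈ K m
  4∈K = low∈K 9≤m (there (there (there (here refl))))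
  m+4∈K : m + 4 ∈ K m
  m+4∈K = top∈K 9≤m (here refl)
  m+6∈K : m + 6 ∈ K m
  m+6∈K = top∈K 9≤m (there (here refl))
  m+7∈K : m + 7 ∈ K m
  m+7∈K = top∈K 9≤m (there (there (here refl)))
  m∈K : m ∈ K m
  m∈K = mid∈K (literal≤m 7) ≤-refl

  m∸d∈K : ∀ d → d ≤ 2 → m ∸ d ∈ K m
  m∸d∈K d d≤2 = mid∈K (≤-trans (∸-monoʳ-≤ 9 d≤2) (∸-monoˡ-≤ d 9≤m)) (m∸n≤m m d)

  borrow : ∀ d e → d ≤ m → m + e ≡ (m ∸ d) + (d + e)
  borrow d e d≤m = begin
    m + e            ≡⟨ cong (_+ e) (m∸n+n≡m d≤m) ⟨
    (m ∸ d + d) + e  ≡⟨ +-assoc (m ∸ d) d e ⟩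
    m ∸ d + (d + e)  ∎
    where open ≡-Reasoning

  below-7 : ∀ n → n < 7 → n ∈ sumset (K m)
  below-7 0 _ = ∈-sumset 0∈K 0∈K
  below-7 1 _ = ∈-sumset 0∈K 1∈K
  below-7 2 _ = ∈-sumset 0∈K 2∈K
  below-7 3 _ = ∈-sumset 1∈K 2∈K
  below-7 4 _ = ∈-sumset 0∈K 4∈K
  below-7 5 _ = ∈-sumset 1∈K 4∈K
  below-7 6 _ = ∈-sumset 2∈K 4∈K
  below-7 (suc (suc (suc (suc (suc (suc (suc _))))))) (s≤s (s≤s (s≤s (s≤s (s≤s (s≤s (s≤s ())))))))

  above-m : ∀ k → 1 ≤ k → k ≤ 13 → m + k ∈ sumset (K m)
  above-m 1  _ _ = ∈-sumset m∈K 1∈K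
  above-m 2  _ _ = ∈-sumset m∈K 2∈K
  above-m 3  _ _ = sum-of (m + 3) (m∸d∈K 1 (s≤s z≤n)) 4∈K (borrow 1 3 (literal≤m 1))
  above-m 4  _ _ = ∈-sumset 0∈K m+4∈K
  above-m 5  _ _ = sum-of (m + 5) (m∸d∈K 2 ≤-refl) (mid∈K ≤-refl (literal≤m 7)) (borrow 2 5 (literal≤m 2))
  above-m 6  _ _ = ∈-sumset 0∈K m+6∈K
  above-m 7  _ _ = ∈-sumset 0∈K m+7∈K
  above-m 8  _ _ = ∈-sumset m∈K (mid∈K (n≤1+n 7) (literal≤m 8))
  above-m 9  _ _ = ∈-sumset m∈K (mid∈K (from-yes (7 ≤? 9)) (literal≤m 9))
  above-m 10 _ _ = sum-of (m + 10) m+6∈K 4∈K (sym (+-assoc m 6 4))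
  above-m 11 _ _ = sum-of (m + 11) m+7∈K 4∈K (sym (+-assoc m 7 4))
  above-m 12 _ _ = sum-of (m + 12) m+4∈K (mid∈K (n≤1+n 7) (literal≤m 8)) (sym (+-assoc m 4 8))
  above-m 13 _ _ = sum-of (m + 13) m+6∈K (mid∈K ≤-refl (literal≤m 7)) (sym (+-assoc m 6 7))
  above-m (suc (suc (suc (suc (suc (suc (suc (suc (suc (suc (suc (suc (suc (suc _)))))))))))))) _
    (s≤s (s≤s (s≤s (s≤s (s≤s (s≤s (s≤s (s≤s (s≤s (s≤s (s≤s (s≤s (s≤s ())))))))))))))
  above-m 0 () _

  2m+8∈sumset : m + (m + 8) ∈ sumset (K m)
  2m+8∈sumset = sum-of (m + (m + 8)) m+4∈K m+4∈K (solve (m ∷ []))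

  -- all sums m + k with 1 ≤ k ≤ m + 8; beyond the table they are
  -- (m + 7) + j with j ∈ [7, m], apart from 2m + 8
  shifted : ∀ k → 1 ≤ k → k < m + 9 → m + k ∈ sumset (K m)
  shifted k 1≤k k<m+9 with k ≤? 13
  ... | yes k≤13 = above-m k 1≤k k≤13
  ... | no k≰13 with k ℕ.≟ m + 8
  ... | yes refl = 2m+8∈sumset
  ... | no k≢m+8 with j , refl ← m≤n⇒∃[o]m+o≡n (≤-trans (from-yes (7 ≤? 14)) (≰⇒> k≰13)) =
    sum-of (m + (7 + j)) m+7∈K (mid∈K 7≤j j≤m) (sym (+-assoc m 7 j))
    where
    7≤j : 7 ≤ j
    7≤j = +-cancelˡ-≤ 7 7 j (≰⇒> k≰13)
    j≤m : j ≤ m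
    j≤m = +-cancelˡ-≤ 7 j m (subst (7 + j ≤_) (+-comm m 7)
            (<+suc⇒≤+ (≤∧≢⇒< (<+suc⇒≤+ k<m+9) k≢m+8)))

  below-2m+9 : ∀ n → n < m + m + 9 → n ∈ sumset (K m)
  below-2m+9 n n<2m+9 with n <? 7 | n ≤? m
  ... | yes n<7 | _       = below-7 n n<7
  ... | no n≮7  | yes n≤m = ∈-sumset 0∈K (mid∈K (≮⇒≥ n≮7) n≤m)
  ... | no _    | no n≰m with k , refl ← m≤n⇒∃[o]m+o≡n (<⇒≤ (≰⇒> n≰m)) =
    shifted k (+-cancelˡ-≤ m 1 k (subst (_≤ m + k) (+-comm 1 m) (≰⇒> n≰m)))
              (+-cancelˡ-< m k (m + 9) (subst (m + k <_) (+-assoc m m 9) n<2m+9))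

  top-sums : ∀ j → j < 5 → suc (m + m + 9) + j ∈ sumset (K m)
  top-sums 0 _ = sum-of (suc (m + m + 9) + 0) m+4∈K m+6∈K (solve (m ∷ []))
  top-sums 1 _ = sum-of (suc (m + m + 9) + 1) m+4∈K m+7∈K (solve (m ∷ []))
  top-sums 2 _ = sum-of (suc (m + m + 9) + 2) m+6∈K m+6∈K (solve (m ∷ []))
  top-sums 3 _ = sum-of (suc (m + m + 9) + 3) m+6∈K m+7∈K (solve (m ∷ []))
  top-sums 4 _ = sum-of (suc (m + m + 9) + 4) m+7∈K m+7∈K (solve (m ∷ []))
  top-sums (suc (suc (suc (suc (suc _))))) (s≤s (s≤s (s≤s (s≤s (s≤s ())))))

  -- [0, 2m+14] without 2m + 9, a duplicate-free list of 2m + 14 sums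
  Sums : List ℕ
  Sums = skip (m + m + 9) (upTo 5)

  Sums⊆sumset : Sums ⊆ sumset (K m)
  Sums⊆sumset n∈ with ∈-skip⁻ n∈
  ... | inj₁ n<2m+9           = below-2m+9 _ n<2m+9
  ... | inj₂ (j , j∈ , refl) = top-sums j (∈-upTo⁻ j∈)

  sumset-size : m + m + 9 + 5 ≤ cardℕ (sumset (K m))
  sumset-size = subst (_≤ cardℕ (sumset (K m)))
    (trans (length-skip (m + m + 9) (upTo 5)) (cong (m + m + 9 +_) (length-upTo 5)))
    (length≤cardℕ (unique-skip (m + m + 9) (Unique.upTo⁺ 5)) Sums⊆sumset)

module DifferenceSet (m : ℕ) where

  -- the offsets i ∈ [0, 2m+14] \ {6, 2m+8}, and the values i − (m + 7)
  Offsets : List ℕ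
  Offsets = skip 6 (skip (m + m + 1) (upTo 6))

  Candidates : List ℤ
  Candidates = map (λ i → ℤ.+ i ℤ.- ℤ.+ (m + 7)) Offsets

  length-Candidates : length Candidates ≡ 6 + (m + m + 1 + 6)
  length-Candidates = begin
    length Candidates                      ≡⟨ length-map _ Offsets ⟩
    length Offsets                         ≡⟨ length-skip 6 (skip (m + m + 1) (upTo 6)) ⟩
    6 + length (skip (m + m + 1) (upTo 6)) ≡⟨ cong (6 +_) (length-skip (m + m + 1) (upTo 6)) ⟩
    6 + (m + m + 1 + length (upTo 6))      ≡⟨ cong (λ l → 6 + (m + m + 1 + l)) (length-upTo 6) ⟩
    6 + (m + m + 1 + 6)                    ∎
    where open ≡-Reasoning

  offset∈ : ∀ {a b i} → a ∈ K m → b ∈ K m → b + i ≡ a + (m + 7) → i ∈ Offsets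
  offset∈ {a} {b} {i} a∈K b∈K b+i≡ = ∈-skip⁺ i≢6 λ i≡7+j → ∈-skip⁺ (j≢2m+1 i≡7+j) (l<6 i≡7+j)
    where
    a≤m+7 : a ≤ m + 7
    a≤m+7 = ∈K⇒≤m+7 {m} a∈K

    i≢6 : i ≢ 6
    i≢6 refl = no-difference-m+1 a∈K b∈K
      (+-cancelʳ-≡ 6 b (m + suc a) (trans b+i≡ (solve (a ∷ m ∷ []))))

    j≢2m+1 : ∀ {j} → i ≡ 7 + j → j ≢ m + m + 1
    j≢2m+1 refl refl = no-difference-m+1 b∈K a∈K
      (+-cancelʳ-≡ (m + 7) a (m + suc b) (trans (sym b+i≡) (solve (b ∷ m ∷ []))))

    l<6 : ∀ {j l} → i ≡ 7 + j → j ≡ suc (m + m + 1) + l → l ∈ upTo 6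
    l<6 {l = l} refl refl = ∈-upTo⁺ (s≤s (≤-trans (m≤m+n l b) (+-cancelʳ-≤ (m + m + 9) (l + b) 5 l+b+2m+9≤)))
      where
      open ≤-Reasoning
      l+b+2m+9≤ : l + b + (m + m + 9) ≤ 5 + (m + m + 9)
      l+b+2m+9≤ = begin
        l + b + (m + m + 9)              ≡⟨ solve (l ∷ b ∷ m ∷ []) ⟩
        b + (7 + (suc (m + m + 1) + l))  ≡⟨ b+i≡ ⟩
        a + (m + 7)                      ≤⟨ +-monoˡ-≤ (m + 7) a≤m+7 ⟩
        (m + 7) + (m + 7)                ≡⟨ solve (m ∷ []) ⟩
        5 + (m + m + 9)                  ∎

  diffset⊆Candidates : diffset (K m) ⊆ Candidates
  diffset⊆Candidates z∈
    with a , b , a∈K , b∈K , refl ← ∈-diffset⁻ z∈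
    with i , b+i≡ ← m≤n⇒∃[o]m+o≡n (≤-trans (∈K⇒≤m+7 {m} b∈K) (m≤n+m (m + 7) a)) =
    subst (_∈ Candidates) (sym (difference-shift a b (m + 7) i b+i≡))
          (∈-map⁺ (λ i → ℤ.+ i ℤ.- ℤ.+ (m + 7)) (offset∈ a∈K b∈K b+i≡))

  diffset-size : cardℤ (diffset (K m)) ≤ 6 + (m + m + 1 + 6)
  diffset-size = subst (cardℤ (diffset (K m)) ≤_) length-Candidates (cardℤ≤length diffset⊆Candidates)

lemma4p1 : (m : ℕ) → 9 ≤ m → SumDominant (K m)
lemma4p1 m 9≤m = begin-strict
  cardℤ (diffset (K m))     ≤⟨ DifferenceSet.diffset-size m ⟩
  6 + (m + m + 1 + 6)       <⟨ n<1+n _ ⟩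
  suc (6 + (m + m + 1 + 6)) ≡⟨ solve (m ∷ []) ⟩
  m + m + 9 + 5             ≤⟨ SumSet.sumset-size m 9≤m ⟩
  cardℕ (sumset (K m))      ∎
  where open ≤-Reasoning
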